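{- Let $S$ be a finite set of alternatives with $|S|\ge 3$, let $V=\{1,\dots,N\}$ be a finite set of voters, and let $f:\Pi_S^V\to\Pi_S$ be a social welfare function. Then $f$ satisfies Independence of Irrelevant Alternatives (IIA) and the Weak Pareto Principle (WPP) if and only if $f$ is directly dictatorial with some dictator $i\in V$ (i.e. for all $x,y\in S$ and all ${\bf R}\in\Pi_S^V$, $x\le_{f({\bf R})}y$ implies $x\le_{R_i}y$), and $f$ defers over $i$ to some clerical-dictatorial function $g:\Pi_S^{V\setminus\{i\}}\to\Pi_S$.
   Context: $\Pi_S$ denotes the set of complete transitive binary relations (weak preferences) on $S$; for $R\in\Pi_S$ we write $x\le_R y$ for $(x,y)\in R$, and $x<_R y$, $x=_R y$ have the obvious meanings. A configuration is ${\bf R}=(R_1,\dots,R_N)\in\Pi_S^V$. A social welfare function (SWF) is any map $f:\Pi_S^V\to\Pi_S$ (for any finite voter set $V$, possibly empty). IIA: whenever ${\bf P},{\bf Q}\in\Pi_S^V$ agree (for every voter) on the pair $\{x,y\}$, $f({\bf P})$ and $f({\bf Q})$ agree on $\{x,y\}$. WPP: if $x<_{R_j}y$ for all $j\in V$ then $x<_{f({\bf R})}y$. $f$ is null if $x=_{f({\bf R})}y$ for all ${\bf R}$ and all $x,y$. $f$ is dictatorial with dictator $i$ if either for all $x,y,{\bf R}$: $x\le_{f({\bf R})}y\Rightarrow x\le_{R_i}y$, or for all $x,y,{\bf R}$: $x\le_{f({\bf R})}y\Rightarrow y\le_{R_i}x$. For ${\bf R}\in\Pi_S^V$, ${\bf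 R}_{ -i}\in\Pi_S^{V\setminus\{i\}}$ is its restriction to voters other than $i$. A dictatorial $f$ with dictator $i$ defers to $g:\Pi_S^{V\setminus\{i\}}\to\Pi_S$ over $i$ if for all $x,y\in S$ and ${\bf R}$ with $x=_{R_i}y$: $x\le_{f({\bf R})}y\iff x\le_{g({\bf R}_{ -i})}y$. $f$ is clerical with cleric $C\in\Pi_S$ if for all $x,y,{\bf R}$: $x\le_{f({\bf R})}y\Rightarrow x\le_C y$. For $A\subseteq S$, the restriction $f|_A:\Pi_A^V\to\Pi_A$ is defined by: given ${\bf R}\in\Pi_A^V$ pick any ${\bf R}'\in\Pi_S^V$ agreeing with ${\bf R}$ on all pairs in $A$, and set $x\le_{f|_A({\bf R})}y$ iff $x\le_{f({\bf R}')}y$ for $x,y\in A$; $f|_A$ is well defined if this does not depend on the choice of ${\bf R}'$. Clerical-dictatorial (recursive definition): $f:\Pi_S^V\to\Pi_S$ is clerical-dictatorial if it is null, or $|S|\le 2$, or there is a cleric $C\in\Pi_S$ such that (1) $f$ is clerical with cleric $C$, and (2) for every equivalence class $A$ of $C$: (a) $f|_A$ is well defined and is null, dictatorial, or $|A|=2$; (b) if $f|_A$ is dictatorial (with dictator $j$) then it defers over $j$ to a clerical-dictatorial function $\Pi_A^{V\setminus\{j\}}\to\Pi_A$. -}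

module Defs where

open import Data.Bool using (Bool; true; false; T; _∧_)
open import Data.Unit using (tt)
open import Data.Empty using (⊥)
open import Data.Product using (Σ; Σ-syntax; _×_; _,_; proj₁; proj₂)
open import Data.Sum using (_⊎_; inj₁; inj₂)
open import Relation.Nullary using (¬_)
open import Relation.Binary.PropositionalEquality using (_≡_; _≢_)
open import Function.Bundles using (_⇔_)
open import Level using (Level)

-- Weak preferences: complete transitive binary relations on X.
-- A relation is encoded as a Bool-valued (i.e. decidable) predicate;
-- rel x y = true means x ≤_R y.

record Pref (X : Set) : Set where
  field
    rel   : X → X → Bool
    total : ∀ x y → T (rel x y) ⊎ T (rel y x)
    trans : ∀ x y z → T (rel x y) → T (rel y z) → T (rel x z)
open Pref public

_⊑[_]_ : {X : Set} → X → Pref X → X → Set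
x ⊑[ R ] y = T (rel R x y)

_⊏[_]_ : {X : Set} → X → Pref X → X → Set
x ⊏[ R ] y = T (rel R x y) × ¬ T (rel R y x)

_≈[_]_ : {X : Set} → X → Pref X → X → Set
x ≈[ R ] y = T (rel R x y) × T (rel R y x)

Config : Set → Set → Set
Config X V = V → Pref X

SWF : Set → Set → Set
SWF X V = Config X V → Pref X

AgreeOn : {X : Set} → Pref X → Pref X → X → X → Set
AgreeOn R R' x y = (rel R x y ≡ rel R' x y) × (rel R y x ≡ rel R' y x)

IIA : {X V : Set} → SWF X V → Set
IIA {X} {V} f = ∀ (P Q : Config X V) (x y : X) →
  (∀ v → AgreeOn (P v) (Q v) x y) → AgreeOn (f P) (f Q) x y

WPP : {X V : Set} → SWF X V → Set
WPP {X} {V} f = ∀ (R : Config X V) (x y : X) →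
  (∀ v → x ⊏[ R v ] y) → x ⊏[ f R ] y

Null : {X V : Set} → SWF X V → Set
Null {X} {V} f = ∀ (R : Config X V) (x y : X) → x ≈[ f R ] y

DirectDictator : {X V : Set} → SWF X V → V → Set
DirectDictator {X} {V} f i = ∀ (x y : X) (R : Config X V) → x ⊑[ f R ] y → x ⊑[ R i ] y

InverseDictator : {X V : Set} → SWF X V → V → Set
InverseDictator {X} {V} f i = ∀ (x y : X) (R : Config X V) → x ⊑[ f R ] y → y ⊑[ R i ] x

Dictator : {X V : Set} → SWF X V → V → Set
Dictator f i = DirectDictator f i ⊎ InverseDictator f i

Dictatorial : {X V : Set} → SWF X V → Set
Dictatorial {X} {V} f = Σ V (Dictator f)

Clerical : {X V : Set} → SWF X V → Pref X → Set
Clerical {X} {V} f C = ∀ (x y : X) (R : Config X V) → x ⊑[ f R ] y → x ⊑[ C ] y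

_∖[_] : (V : Set) → V → Set
V ∖[ i ] = Σ V (λ k → k ≢ i)

drop : {X V : Set} (i : V) → Config X V → Config X (V ∖[ i ])
drop i R k = R (proj₁ k)

Defers : {X V : Set} → SWF X V → (i : V) → SWF X (V ∖[ i ]) → Set
Defers {X} {V} f i g = ∀ (x y : X) (R : Config X V) → x ≈[ R i ] y →
  (x ⊑[ f R ] y ⇔ x ⊑[ g (drop i R) ] y)

AtMostTwo : Set → Set
AtMostTwo X = ∀ (x y z : X) → x ≡ y ⊎ y ≡ z ⊎ x ≡ z

ExactlyTwo : Set → Set
ExactlyTwo X = Σ X λ a → Σ X λ b → a ≢ b × (∀ x → x ≡ a ⊎ x ≡ b)

Sub : {X : Set} → (X → Bool) → Set
Sub {X} p = Σ X (λ x → T (p x))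

restrictPref : {X : Set} (p : X → Bool) → Pref X → Pref (Sub p)
rel   (restrictPref p R) a b = rel R (proj₁ a) (proj₁ b)
total (restrictPref p R) a b = total R (proj₁ a) (proj₁ b)
trans (restrictPref p R) a b c = trans R (proj₁ a) (proj₁ b) (proj₁ c)

-- Extension of a preference on a subset A to all of X: the order on A is
-- kept, and all elements outside A are tied below every element of A.
extRel' : (b c : Bool) → (T b → T c → Bool) → Bool
extRel' true  true  k = k tt tt
extRel' true  false k = false
extRel' false c     k = true

private
  extTotal : ∀ b c (k : T b → T c → Bool) (k' : T c → T b → Bool) →
    (∀ pb pc → T (k pb pc) ⊎ T (k' pc pb)) →
    T (extRel' b c k) ⊎ T (extRel' c b k')
  extTotal true  true  k k' h = h tt tt
  extTotal true  false k k' h = inj₂ tt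
  extTotal false c     k k' h = inj₁ tt

  extTrans : ∀ b c d (k1 : T b → T c → Bool) (k2 : T c → T d → Bool)
    (k3 : T b → T d → Bool) →
    (∀ pb pc pd → T (k1 pb pc) → T (k2 pc pd) → T (k3 pb pd)) →
    T (extRel' b c k1) → T (extRel' c d k2) → T (extRel' b d k3)
  extTrans true  true  true  k1 k2 k3 h u v = h tt tt tt u v
  extTrans true  true  false k1 k2 k3 h u ()
  extTrans true  false d     k1 k2 k3 h () v
  extTrans false c     d     k1 k2 k3 h u v = tt

extendPref : {X : Set} (p : X → Bool) → Pref (Sub p) → Pref X
rel   (extendPref p R) x y = extRel' (p x) (p y) (λ px py → rel R (x , px) (y , py))
total (extendPref p R) x y =
  extTotal (p x) (p y) _ _ (λ px py → total R (x , px) (y , py))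
trans (extendPref p R) x y z =
  extTrans (p x) (p y) (p z) _ _ _ (λ px py pz → trans R (x , px) (y , py) (z , pz))

RestrictionWellDefined : {X V : Set} → SWF X V → (X → Bool) → Set
RestrictionWellDefined {X} {V} f p = ∀ (P Q : Config X V) →
  (∀ v (x y : X) → T (p x) → T (p y) → AgreeOn (P v) (Q v) x y) →
  ∀ (x y : X) → T (p x) → T (p y) → AgreeOn (f P) (f Q) x y

-- f|_A : Π_A^V → Π_A, computed via one particular extension of each
-- configuration (meaningful when RestrictionWellDefined f p holds).
restrictSWF : {X V : Set} → SWF X V → (p : X → Bool) → SWF (Sub p) V
restrictSWF f p R = restrictPref p (f (λ v → extendPref p (R v)))

classOf : {X : Set} → Pref X → X → (X → Bool)
classOf C a y = rel C y a ∧ rel C a y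

-- Clerical-dictatorial social welfare functions (inductive reading of the
-- recursive definition; the recursion decreases the voter set).

data ClericalDictatorial : (X V : Set) → SWF X V → Set₁ where
  cd-null  : {X V : Set} {f : SWF X V} → Null f → ClericalDictatorial X V f
  cd-small : {X V : Set} {f : SWF X V} → AtMostTwo X → ClericalDictatorial X V f
  cd-cleric : {X V : Set} {f : SWF X V} (C : Pref X) →
    Clerical f C →
    (∀ (a : X) →
      RestrictionWellDefined f (classOf C a) ×
      (Null (restrictSWF f (classOf C a)) ⊎
       Dictatorial (restrictSWF f (classOf C a)) ⊎
       ExactlyTwo (Sub (classOf C a)))) →
    (∀ (a : X) (j : V) → Dictator (restrictSWF f (classOf C a)) j →
      Σ (SWF (Sub (classOf C a)) (V ∖[ j ])) λ g →
        Defers (restrictSWF f (classOf C a)) j g ×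
        ClericalDictatorial (Sub (classOf C a)) (V ∖[ j ]) g) →
    ClericalDictatorial X V f

-- Arrow's argument (decisive coalitions spread to all pairs and contract to a single voter)
-- gives f a direct dictator i. Making every voter with the index of i indifferent yields an SWF
-- g of the other voters to which f defers. Every SWF g satisfying IIA is clerical-dictatorial:
-- "x ⊑ y in g R for some profile R" is a weak order C (profiles are merged using IIA), it is
-- refined by every value of g, and on an equivalence class of C every pair can be ordered
-- either way. On a class with at least three elements Wilson's theorem then makes the
-- restriction of g null or dictatorial: unanimity on a pair is either followed, opposed or
-- ignored by society, the same everywhere, and Arrow's argument applies to g or to its dual.
-- A dictatorial restriction defers to an SWF with one voter fewer, and the recursion ends.
-- Conversely, f follows the strict preferences of i and resolves the ties of i through g, and a
-- clerical-dictatorial SWF satisfies IIA by induction on its definition.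

module Submission where

open import Defs
open import Data.Bool using (Bool; true; false; T; _∧_; if_then_else_)
open import Data.Bool.Properties using (T-irrelevant; T-∧)
open import Data.Empty using (⊥; ⊥-elim)
open import Data.Fin using (Fin; zero; suc; toℕ) renaming (_≟_ to _≟ᶠ_)
open import Data.Fin.Subset using (Subset; inside; outside; _∈_; _∉_; _─_; _-_; ⁅_⁆; ∣_∣; ⊤)
open import Data.Fin.Properties using () renaming (any? to any?ᶠ)
open import Data.Fin.Subset.Properties
  using (_∈?_; p─q⊆p; x∈⁅x⁆; x∈⁅y⁆⇒x≡y; x∈p∧x≢y⇒x∈p-y; x∉⁅y⁆⇒x≢y; nonempty?; x∈p⇒∣p-x∣<∣p∣; ∣p∣≤n; ∈⊤)
open import Data.Vec using (Vec; []; _∷_; here; there; lookup; tabulate; replicate)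
open import Data.Vec.Properties using (lookup∘tabulate)
open import Data.List using (List; []; _∷_; allFin)
open import Data.List.Membership.Propositional.Properties using (∈-allFin)
open import Data.List.Membership.Propositional using (find; lose) renaming (_∈_ to _∈ˡ_)
open import Data.List.Relation.Unary.Any using (any?; here; there)
open import Data.Nat using (ℕ; zero; suc; _+_; _≤_; _≤ᵇ_; _<ᵇ_; _<_; s≤s; s≤s⁻¹)
open import Data.Nat.Properties using (≤-total; ≤-trans; ≤ᵇ⇒≤; ≤⇒≤ᵇ; <ᵇ⇒<; <⇒≤; <⇒≱; <-≤-trans; n<1+n)
open import Data.Product using (Σ; ∃; _×_; _,_; proj₁; proj₂; map₂)
open import Data.Sum using (_⊎_; inj₁; inj₂)
import Data.Sum as Sum
open import Data.Unit using (tt)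
open import Function using (_∘_; const; id)
open import Function.Bundles using (_⇔_; mk⇔; Equivalence)
open import Relation.Binary.Definitions using (DecidableEquality)
open import Relation.Binary.PropositionalEquality
  using (_≡_; _≢_; refl; sym; cong; cong₂; subst) renaming (trans to ≡-trans)
open import Relation.Nullary using (¬_; Dec; yes; no; does; contradiction)
open import Relation.Nullary.Decidable
  using (dec-true; dec-false; T?; map′; ¬?; _×-dec_; decidable-stable; toWitness; fromWitness; ⌊_⌋)

private
  variable
    X V : Set
    x y z : X
    P Q U : Pref X

T-ext : ∀ {a b} → (T a → T b) → (T b → T a) → a ≡ b
T-ext {true}  {true}  _ _ = refl
T-ext {true}  {false} f _ = ⊥-elim (f tt)
T-ext {false} {true}  _ g = ⊥-elim (g tt)
T-ext {false} {false} _ _ = refl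

module _ (R : Pref X) where

  ⊑-refl : (x : X) → x ⊑[ R ] x
  ⊑-refl x with total R x x
  ... | inj₁ x⊑x = x⊑x
  ... | inj₂ x⊑x = x⊑x

  ⋢⇒⊏ : ¬ x ⊑[ R ] y → y ⊏[ R ] x
  ⋢⇒⊏ {x = x} {y} x⋢y with total R x y
  ... | inj₁ x⊑y = contradiction x⊑y x⋢y
  ... | inj₂ y⊑x = y⊑x , x⋢y

  ⊑-⊏-trans : x ⊑[ R ] y → y ⊏[ R ] z → x ⊏[ R ] z
  ⊑-⊏-trans {x = x} {y} {z} x⊑y (y⊑z , z⋢y) =
    trans R x y z x⊑y y⊑z , λ z⊑x → z⋢y (trans R z x y z⊑x x⊑y)

  ⊏-trans : x ⊏[ R ] y → y ⊏[ R ] z → x ⊏[ R ] z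
  ⊏-trans x⊏y = ⊑-⊏-trans (proj₁ x⊏y)

  ⊏-asym : x ⊏[ R ] y → ¬ y ⊏[ R ] x
  ⊏-asym (x⊑y , _) (_ , x⋢y) = x⋢y x⊑y

  ⊏⇒≢ : x ⊏[ R ] y → x ≢ y
  ⊏⇒≢ x⊏x refl = ⊏-asym x⊏x x⊏x

  compare : (x y : X) → x ⊏[ R ] y ⊎ x ≈[ R ] y ⊎ y ⊏[ R ] x
  compare x y with T? (rel R x y) | T? (rel R y x)
  ... | yes x⊑y | yes y⊑x = inj₂ (inj₁ (x⊑y , y⊑x))
  ... | yes x⊑y | no  y⋢x = inj₁ (x⊑y , y⋢x)
  ... | no  x⋢y | _       = inj₂ (inj₂ (⋢⇒⊏ x⋢y))

-- AgreeOn as a record, so that the preferences and the pair can be inferred.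
record Agree (P Q : Pref X) (x y : X) : Set where
  constructor agree
  field
    ≡-forth : rel P x y ≡ rel Q x y
    ≡-back  : rel P y x ≡ rel Q y x
open Agree public

toAgree : AgreeOn P Q x y → Agree P Q x y
toAgree (e₁ , e₂) = agree e₁ e₂

fromAgree : Agree P Q x y → AgreeOn P Q x y
fromAgree (agree e₁ e₂) = e₁ , e₂

iia-agree : {h : SWF X V} → IIA h → (P Q : Config X V) (x y : X) →
  (∀ v → Agree (P v) (Q v) x y) → Agree (h P) (h Q) x y
iia-agree {h = h} iia P Q x y P~Q =
  toAgree {P = h P} {Q = h Q} {x = x} {y = y} (iia P Q x y (fromAgree ∘ P~Q))

agree-refl : Agree P P x y
agree-refl = agree refl refl

agree-≡ : P ≡ Q → Agree P Q x y
agree-≡ refl = agree-refl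

agree-sym : Agree P Q x y → Agree Q P x y
agree-sym (agree e₁ e₂) = agree (sym e₁) (sym e₂)

agree-trans : Agree P Q x y → Agree Q U x y → Agree P U x y
agree-trans (agree e₁ e₂) (agree f₁ f₂) = agree (≡-trans e₁ f₁) (≡-trans e₂ f₂)

agree-swap : Agree P Q x y → Agree P Q y x
agree-swap (agree e₁ e₂) = agree e₂ e₁

agree-⊑ : Agree P Q x y → x ⊑[ P ] y → x ⊑[ Q ] y
agree-⊑ a = subst T (≡-forth a)

agree-⇔ : Agree P Q x y → (x ⊑[ P ] y ⇔ x ⊑[ Q ] y)
agree-⇔ a = mk⇔ (agree-⊑ a) (agree-⊑ (agree-sym a))

agree-⊏ : Agree P Q x y → x ⊏[ P ] y → x ⊏[ Q ] y
agree-⊏ a (x⊑y , y⋢x) = agree-⊑ a x⊑y , y⋢x ∘ agree-⊑ (agree-sym (agree-swap a))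

agree-≈ : Agree P Q x y → x ≈[ P ] y → x ≈[ Q ] y
agree-≈ a (x⊑y , y⊑x) = agree-⊑ a x⊑y , agree-⊑ (agree-swap a) y⊑x

⇔-agree : (x ⊑[ P ] y ⇔ x ⊑[ Q ] y) → (y ⊑[ P ] x ⇔ y ⊑[ Q ] x) → Agree P Q x y
⇔-agree e f =
  agree (T-ext (Equivalence.to e) (Equivalence.from e)) (T-ext (Equivalence.to f) (Equivalence.from f))

⊏-agree : x ⊏[ P ] y → x ⊏[ Q ] y → Agree P Q x y
⊏-agree (p₁ , p₂) (q₁ , q₂) = agree (T-ext (const q₁) (const p₁)) (T-ext (⊥-elim ∘ p₂) (⊥-elim ∘ q₂))

≈-agree : x ≈[ P ] y → x ≈[ Q ] y → Agree P Q x y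
≈-agree (p₁ , p₂) (q₁ , q₂) = agree (T-ext (const q₁) (const p₁)) (T-ext (const q₂) (const p₂))

tie-rel : (P : Pref X) → x ≈[ P ] y → ∀ z → rel P x z ≡ rel P y z
tie-rel {x = x} {y} P (x⊑y , y⊑x) z = T-ext (trans P y x z y⊑x) (trans P x y z x⊑y)

tie-rel′ : (P : Pref X) → x ≈[ P ] y → ∀ z → rel P z x ≡ rel P z y
tie-rel′ {x = x} {y} P (x⊑y , y⊑x) z = T-ext (λ z⊑x → trans P z x y z⊑x x⊑y) (λ z⊑y → trans P z y x z⊑y y⊑x)

tie-transfer : x ≈[ P ] y → x ≈[ Q ] y → Agree P Q x z → Agree P Q y z
tie-transfer {P = P} {Q = Q} {z = z} x≈ᴾy x≈ᵠy (agree e₁ e₂) =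
  agree (≡-trans (sym (tie-rel P x≈ᴾy z)) (≡-trans e₁ (tie-rel Q x≈ᵠy z)))
        (≡-trans (sym (tie-rel′ P x≈ᴾy z)) (≡-trans e₂ (tie-rel′ Q x≈ᵠy z)))

agree-diag : (P Q : Pref X) (x : X) → Agree P Q x x
agree-diag P Q x = ≈-agree (⊑-refl P x , ⊑-refl P x) (⊑-refl Q x , ⊑-refl Q x)

byRank : (X → ℕ) → Pref X
rel   (byRank r) a b   = r a ≤ᵇ r b
total (byRank r) a b with ≤-total (r a) (r b)
... | inj₁ ra≤rb = inj₁ (≤⇒≤ᵇ ra≤rb)
... | inj₂ rb≤ra = inj₂ (≤⇒≤ᵇ rb≤ra)
trans (byRank r) a b c p q = ≤⇒≤ᵇ (≤-trans (≤ᵇ⇒≤ (r a) (r b) p) (≤ᵇ⇒≤ (r b) (r c) q))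

indifference : Pref X
indifference = byRank (const 0)

byRank-⊏ : (r : X → ℕ) → ∀ {m n} → r x ≡ m → r y ≡ n → T (m <ᵇ n) → x ⊏[ byRank r ] y
byRank-⊏ r {m} {n} refl refl m<ᵇn =
  ≤⇒≤ᵇ (<⇒≤ m<n) , λ n≤ᵇm → <⇒≱ m<n (≤ᵇ⇒≤ n m n≤ᵇm)
  where m<n = <ᵇ⇒< m n m<ᵇn

-- The position of a relative to b in a preference, as a rank 1, 2 or 3 against rank 2 for b.
rankCode : Bool → Bool → Fin 3
rankCode true  false = zero
rankCode false true  = suc (suc zero)
rankCode _     _     = suc zero

code : Pref X → X → X → Fin 3
code R a b = rankCode (rel R a b) (rel R b a)

rankCode-≤ᵇ : ∀ {p q} → T p ⊎ T q →
  ((suc (toℕ (rankCode p q)) ≤ᵇ 2) ≡ p) × ((2 ≤ᵇ suc (toℕ (rankCode p q))) ≡ q)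
rankCode-≤ᵇ {true}  {true}  _ = refl , refl
rankCode-≤ᵇ {true}  {false} _ = refl , refl
rankCode-≤ᵇ {false} {true}  _ = refl , refl
rankCode-≤ᵇ {false} {false} (inj₁ ())
rankCode-≤ᵇ {false} {false} (inj₂ ())

byRank-agree : (r : X → ℕ) {R : Pref X} → r x ≡ suc (toℕ (code R x y)) → r y ≡ 2 →
  Agree (byRank r) R x y
byRank-agree {x = x} {y} r {R} rx ry =
  agree (≡-trans (cong₂ _≤ᵇ_ rx ry) (proj₁ ranks)) (≡-trans (cong₂ _≤ᵇ_ ry rx) (proj₂ ranks))
  where ranks = rankCode-≤ᵇ (total R x y)

rank<4 : (k : Fin 3) → T (suc (toℕ k) <ᵇ 4)
rank<4 zero             = tt
rank<4 (suc zero)       = tt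
rank<4 (suc (suc zero)) = tt

singledRank : DecidableEquality X → X → ℕ → X → ℕ
singledRank _≟_ a r c = if does (c ≟ a) then r else 2

opaque
  singled : DecidableEquality X → X → ℕ → Pref X
  singled _≟_ a r = byRank (singledRank _≟_ a r)

module TwoPoints (_≟_ : DecidableEquality X) {a b : X} (a≢b : a ≢ b) where

  profile2 : ℕ → Pref X
  profile2 = singled _≟_ a

  opaque
    unfolding singled

    private
      at-a : ∀ {r} → singledRank _≟_ a r a ≡ r
      at-a rewrite dec-true (a ≟ a) refl = refl

      at-b : ∀ {r} → singledRank _≟_ a r b ≡ 2
      at-b rewrite dec-false (b ≟ a) (a≢b ∘ sym) = refl

    profile2-⊏ : ∀ {r} → T (r <ᵇ 2) → a ⊏[ profile2 r ] b
    profile2-⊏ {r} = byRank-⊏ (singledRank _≟_ a r) at-a at-b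

    profile2-⊐ : ∀ {r} → T (2 <ᵇ r) → b ⊏[ profile2 r ] a
    profile2-⊐ {r} = byRank-⊏ (singledRank _≟_ a r) at-b at-a

    profile2-agree : (R : Pref X) → Agree (profile2 (suc (toℕ (code R a b)))) R a b
    profile2-agree R = byRank-agree (singledRank _≟_ a _) at-a at-b

  untie : Pref X → Pref X
  untie P = if rel P a b ∧ rel P b a then profile2 3 else P

  untie-≈ : ∀ {P} → a ≈[ P ] b → b ⊏[ untie P ] a
  untie-≈ {P} (a⊑b , b⊑a) with rel P a b | rel P b a
  ... | true | true = profile2-⊐ tt

  untie-⊏ : ∀ {P} → a ⊏[ P ] b → untie P ≡ P
  untie-⊏ {P} (a⊑b , b⋢a) with rel P a b | rel P b a
  ... | true  | false = refl
  ... | _     | true  = ⊥-elim (b⋢a tt)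

module ThreePoints (_≟_ : DecidableEquality X) {x y z : X} (x≢y : x ≢ y) (x≢z : x ≢ z) (y≢z : y ≢ z) where

  -- Opaque, so that ranks can be read off from a goal by unification.
  opaque
    rank3 : ℕ → ℕ → ℕ → X → ℕ
    rank3 rx ry rz a = if does (a ≟ x) then rx else if does (a ≟ y) then ry else rz

    profile3 : ℕ → ℕ → ℕ → Pref X
    profile3 rx ry rz = byRank (rank3 rx ry rz)

    profile3-⊏ : ∀ {rx ry rz a b m n} → rank3 rx ry rz a ≡ m → rank3 rx ry rz b ≡ n → T (m <ᵇ n) →
      a ⊏[ profile3 rx ry rz ] b
    profile3-⊏ {rx} {ry} {rz} = byRank-⊏ (rank3 rx ry rz)

    profile3-agree : ∀ {rx ry rz a b} {R : Pref X} → rank3 rx ry rz a ≡ suc (toℕ (code R a b)) →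
      rank3 rx ry rz b ≡ 2 → Agree (profile3 rx ry rz) R a b
    profile3-agree {rx} {ry} {rz} = byRank-agree (rank3 rx ry rz)

    profile3-same-ranks : ∀ {rx ry rz rx′ ry′ rz′ a b} → rank3 rx ry rz a ≡ rank3 rx′ ry′ rz′ a →
      rank3 rx ry rz b ≡ rank3 rx′ ry′ rz′ b → Agree (profile3 rx ry rz) (profile3 rx′ ry′ rz′) a b
    profile3-same-ranks ea eb = agree (cong₂ _≤ᵇ_ ea eb) (cong₂ _≤ᵇ_ eb ea)

  module _ {rx ry rz : ℕ} where
    opaque
      unfolding rank3

      at-x : rank3 rx ry rz x ≡ rx
      at-x rewrite dec-true (x ≟ x) refl = refl

      at-y : rank3 rx ry rz y ≡ ry
      at-y rewrite dec-false (y ≟ x) (x≢y ∘ sym) | dec-true (y ≟ y) refl = refl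

      at-z : rank3 rx ry rz z ≡ rz
      at-z rewrite dec-false (z ≟ x) (x≢z ∘ sym) | dec-false (z ≟ y) (y≢z ∘ sym) = refl

reversed : Pref X → Pref X
rel   (reversed R) a b     = rel R b a
total (reversed R) a b     = total R b a
trans (reversed R) a b c p q = trans R c b a q p

reversed-involutive : (P : Pref X) → Agree P (reversed (reversed P)) x y
reversed-involutive P = agree refl refl

dual : SWF X V → SWF X V
dual h R = h (reversed ∘ R)

dual-reversed : {h : SWF X V} → IIA h → (R : Config X V) (x y : X) → Agree (h R) (dual h (reversed ∘ R)) x y
dual-reversed {h = h} iia R x y =
  iia-agree {h = h} iia R (reversed ∘ reversed ∘ R) x y (reversed-involutive ∘ R)

dictator-⊏ : {h : SWF X V} {j : V} → DirectDictator h j → (R : Config X V) → x ⊏[ R j ] y → x ⊏[ h R ] y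
dictator-⊏ {x = x} {y} {h = h} dd R (_ , y⋢x) = ⋢⇒⊏ (h R) (y⋢x ∘ dd y x R)

inverseDictator-⊏ : {h : SWF X V} {j : V} → InverseDictator h j → (R : Config X V) →
  x ⊏[ R j ] y → y ⊏[ h R ] x
inverseDictator-⊏ {x = x} {y} {h = h} inv R (_ , y⋢x) = ⋢⇒⊏ (h R) (y⋢x ∘ inv x y R)

dictator-⊏-agree : {h : SWF X V} {j : V} → Dictator h j → (P Q : Config X V) →
  x ⊏[ P j ] y → x ⊏[ Q j ] y → Agree (h P) (h Q) x y
dictator-⊏-agree {h = h} (inj₁ dd)  P Q x⊏ᴾy x⊏ᵠy =
  ⊏-agree (dictator-⊏ {h = h} dd P x⊏ᴾy) (dictator-⊏ {h = h} dd Q x⊏ᵠy)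
dictator-⊏-agree {h = h} (inj₂ inv) P Q x⊏ᴾy x⊏ᵠy =
  agree-swap (⊏-agree (inverseDictator-⊏ {h = h} inv P x⊏ᴾy) (inverseDictator-⊏ {h = h} inv Q x⊏ᵠy))

inverse⇒dual-direct : {h : SWF X V} {j : V} → InverseDictator h j → DirectDictator (dual h) j
inverse⇒dual-direct inv x y R = inv x y (reversed ∘ R)

dual-direct⇒inverse : {h : SWF X V} {j : V} → IIA h → DirectDictator (dual h) j → InverseDictator h j
dual-direct⇒inverse {h = h} iia d x y R x⊑y =
  d x y (reversed ∘ R) (agree-⊑ (dual-reversed {h = h} iia R x y) x⊑y)

-- A voter set V ∖[ j ] has no usable equality (proofs of k ≢ j are not unique), so voters are
-- handled through indices: each live index has a representative, and all other voters are
-- ignored by the SWFs considered (see IndexedIIA).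
record Indexing (V : Set) : Set where
  field
    size      : ℕ
    index     : V → Fin size
    live      : Subset size
    rep       : {k : Fin size} → k ∈ live → V
    index-rep : {k : Fin size} (k∈ : k ∈ live) → index (rep k∈) ≡ k
open Indexing public

∈-irrelevant : ∀ {n} {k : Fin n} {p : Subset n} (a b : k ∈ p) → a ≡ b
∈-irrelevant here      here      = refl
∈-irrelevant (there a) (there b) = cong there (∈-irrelevant a b)

∈─⇒∉ : ∀ {n} {k : Fin n} (p q : Subset n) → k ∈ p ─ q → k ∉ q
∈─⇒∉ (inside ∷ p) (outside ∷ q) here ()
∈─⇒∉ (_ ∷ p) (_ ∷ q) (there k∈p─q) (there k∈q) = ∈─⇒∉ p q k∈p─q k∈q

∈-⇒≢ : ∀ {n} {k l : Fin n} (p : Subset n) → k ∈ p - l → k ≢ l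
∈-⇒≢ {l = l} p k∈p-l refl = ∈─⇒∉ p ⁅ l ⁆ k∈p-l (x∈⁅x⁆ l)

module _ (I : Indexing V) where

  rep-cong : ∀ {k l} → k ≡ l → (k∈ : k ∈ live I) (l∈ : l ∈ live I) → rep I k∈ ≡ rep I l∈
  rep-cong refl k∈ l∈ = cong (rep I) (∈-irrelevant k∈ l∈)

  select : Subset (size I) → Config X V → Config X V → Config X V
  select G A B v = if does (index I v ∈? G) then A v else B v

  copy-rep : ∀ {k} (k∈ : k ∈ live I) (R : Config X V) → ∀ {l} (l∈ : l ∈ live I) →
    select ⁅ k ⁆ (const (R (rep I k∈))) R (rep I l∈) ≡ R (rep I l∈)
  copy-rep {k = k} k∈ R {l} l∈ with index I (rep I l∈) ∈? ⁅ k ⁆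
  ... | yes ∈⁅k⁆ = cong R (rep-cong (≡-trans (sym (x∈⁅y⁆⇒x≡y k ∈⁅k⁆)) (index-rep I l∈)) k∈ l∈)
  ... | no  _    = refl

  select-own : (A B : Config X V) (v : V) → select ⁅ index I v ⁆ A B v ≡ A v
  select-own A B v rewrite dec-true (index I v ∈? ⁅ index I v ⁆) (x∈⁅x⁆ _) = refl

  select-dead : ∀ {k} → k ∉ live I → (A B : Config X V) → ∀ {l} (l∈ : l ∈ live I) →
    select ⁅ k ⁆ A B (rep I l∈) ≡ B (rep I l∈)
  select-dead {k = k} k∉ A B l∈ with index I (rep I l∈) ∈? ⁅ k ⁆
  ... | yes ∈⁅k⁆ =
    contradiction (subst (_∈ live I) (≡-trans (sym (index-rep I l∈)) (x∈⁅y⁆⇒x≡y k ∈⁅k⁆)) l∈) k∉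
  ... | no  _    = refl

  -- Only representatives are consulted; this is what lets the voters be enumerated by index.
  IndexedIIA : SWF X V → Set
  IndexedIIA {X} h = ∀ (P Q : Config X V) (x y : X) →
    (∀ {k} (k∈ : k ∈ live I) → Agree (P (rep I k∈)) (Q (rep I k∈)) x y) → Agree (h P) (h Q) x y

  indexedIIA⇒IIA : {h : SWF X V} → IndexedIIA h → IIA h
  indexedIIA⇒IIA iia P Q x y P~Q = fromAgree (iia P Q x y (λ _ → toAgree (P~Q _)))

  dead-unconsulted : {h : SWF X V} → IndexedIIA h → ∀ {k} → k ∉ live I → (A B R : Config X V) (x y : X) →
    Agree (h (select ⁅ k ⁆ A R)) (h (select ⁅ k ⁆ B R)) x y
  dead-unconsulted iia k∉ A B R x y = iia _ _ x y λ l∈ →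
    agree-≡ (≡-trans (select-dead k∉ A R l∈) (sym (select-dead k∉ B R l∈)))

  dual-indexedIIA : {h : SWF X V} → IndexedIIA h → IndexedIIA (dual h)
  dual-indexedIIA iia P Q x y P~Q =
    iia _ _ x y (λ k∈ → agree (≡-back (P~Q k∈)) (≡-forth (P~Q k∈)))

_∖ᵢ_ : (I : Indexing V) (j : V) → Indexing (V ∖[ j ])
size      (I ∖ᵢ j)    = size I
index     (I ∖ᵢ j)    = index I ∘ proj₁
live      (I ∖ᵢ j)    = live I - index I j
rep       (I ∖ᵢ j) k∈ = rep I (p─q⊆p _ _ k∈) , λ rep≡j →
  ∈-⇒≢ (live I) k∈ (≡-trans (sym (index-rep I _)) (cong (index I) rep≡j))
index-rep (I ∖ᵢ j) k∈ = index-rep I _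

removed-index : (I : Indexing V) → ∀ {j l} → l ∈ live I → l ∉ live (I ∖ᵢ j) → l ≡ index I j
removed-index I {j} {l} l∈ l∉ with l ≟ᶠ index I j
... | yes l≡j = l≡j
... | no  l≢j = contradiction (x∈p∧x≢y⇒x∈p-y l∈ l≢j) l∉

record AtLeastThree (X : Set) : Set where
  constructor distinct3
  field
    {x₀ y₀ z₀} : X
    x₀≢y₀ : x₀ ≢ y₀
    x₀≢z₀ : x₀ ≢ z₀
    y₀≢z₀ : y₀ ≢ z₀

module Pairs (_≟_ : DecidableEquality X) (three : AtLeastThree X) where
  open AtLeastThree three

  third : (a b : X) → ∃ λ c → c ≢ a × c ≢ b
  third a b with x₀ ≟ a | x₀ ≟ b | y₀ ≟ a | y₀ ≟ b
  ... | no  x₀≢a  | no  x₀≢b  | _         | _         = x₀ , x₀≢a , x₀≢b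
  ... | _         | _         | no  y₀≢a  | no  y₀≢b  = y₀ , y₀≢a , y₀≢b
  ... | yes x₀≡a  | _         | yes y₀≡a  | _         = ⊥-elim (x₀≢y₀ (≡-trans x₀≡a (sym y₀≡a)))
  ... | _         | yes x₀≡b  | _         | yes y₀≡b  = ⊥-elim (x₀≢y₀ (≡-trans x₀≡b (sym y₀≡b)))
  ... | yes refl  | _         | _         | yes refl  = z₀ , x₀≢z₀ ∘ sym , y₀≢z₀ ∘ sym
  ... | _         | yes refl  | yes refl  | _         = z₀ , y₀≢z₀ ∘ sym , x₀≢z₀ ∘ sym

  module _ (Q : X → X → Set)
    (right : ∀ {a b c} → a ≢ b → c ≢ a → c ≢ b → Q a b → Q a c)
    (left  : ∀ {a b c} → a ≢ b → c ≢ a → c ≢ b → Q a b → Q c b) where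

    private
      right′ : ∀ {a b c} → a ≢ b → c ≢ a → Q a b → Q a c
      right′ {b = b} {c} a≢b c≢a q with c ≟ b
      ... | yes refl = q
      ... | no c≢b   = right a≢b c≢a c≢b q

      left′ : ∀ {a b c} → a ≢ b → c ≢ b → Q a b → Q c b
      left′ {a = a} {c = c} a≢b c≢b q with c ≟ a
      ... | yes refl = q
      ... | no c≢a   = left a≢b c≢a c≢b q

    all-pairs : ∀ {a b} → a ≢ b → Q a b → ∀ {c d} → c ≢ d → Q c d
    all-pairs {a} {b} a≢b q {c} {d} c≢d with c ≟ b | d ≟ a
    ... | no c≢b   | _        = right′ c≢b (c≢d ∘ sym) (left′ a≢b c≢b q)
    ... | yes refl | no d≢a   = left′ (d≢a ∘ sym) c≢d (right′ a≢b d≢a q)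
    ... | yes refl | yes refl with third a c
    ...   | w , w≢a , w≢c =
            right′ (w≢c ∘ sym) a≢b (left′ (w≢a ∘ sym) (w≢c ∘ sym) (right a≢b w≢a w≢c q))

module Arrow (_≟_ : DecidableEquality X) (three : AtLeastThree X) (I : Indexing V)
  {h : SWF X V} (iia : IndexedIIA I h) (wpp : WPP h) where

  open AtLeastThree three
  open Pairs _≟_ three

  Coalition : Set
  Coalition = Subset (size I)

  Decisive : Coalition → X → X → Set
  Decisive G a b = ∀ R → (∀ v → index I v ∈ G → a ⊏[ R v ] b) → a ⊏[ h R ] b

  AlmostDecisive : Coalition → X → X → Set
  AlmostDecisive G a b = ∀ R → (∀ v → index I v ∈ G → a ⊏[ R v ] b) →
    (∀ v → index I v ∉ G → b ⊏[ R v ] a) → a ⊏[ h R ] b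

  DecisiveForAll : Coalition → Set
  DecisiveForAll G = ∀ {a b} → a ≢ b → Decisive G a b

  module _ {G : Coalition} {a b c : X} (a≢b : a ≢ b) (c≢a : c ≢ a) (c≢b : c ≢ b)
    (ad : AlmostDecisive G a b) where

    open ThreePoints _≟_ a≢b (c≢a ∘ sym) (c≢b ∘ sym)

    -- G makes a beat b while everybody puts b below c, and a and c are ordered as in R.
    almost⇒decisive-right : Decisive G a c
    almost⇒decisive-right R R-G = agree-⊏ (iia S R a c (λ k∈ → S~R (rep I k∈))) (⊏-trans (h S) a⊏b b⊏c)
      where
      S : Config X V
      S = select I G (const (profile3 0 1 2)) (λ v → profile3 (suc (toℕ (code (R v) a c))) 0 2)
      a⊏b : a ⊏[ h S ] b
      a⊏b = ad S in-G out-G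
        where
        in-G : ∀ v → index I v ∈ G → a ⊏[ S v ] b
        in-G v v∈G with index I v ∈? G
        ... | yes _    = profile3-⊏ at-x at-y tt
        ... | no  v∉G  = contradiction v∈G v∉G
        out-G : ∀ v → index I v ∉ G → b ⊏[ S v ] a
        out-G v v∉G with index I v ∈? G
        ... | yes v∈G = contradiction v∈G v∉G
        ... | no  _   = profile3-⊏ at-y at-x tt
      b⊏c : b ⊏[ h S ] c
      b⊏c = wpp S b c b⊏c-everywhere
        where
        b⊏c-everywhere : ∀ v → b ⊏[ S v ] c
        b⊏c-everywhere v with index I v ∈? G
        ... | yes _ = profile3-⊏ at-y at-z tt
        ... | no  _ = profile3-⊏ at-y at-z tt
      S~R : ∀ v → Agree (S v) (R v) a c
      S~R v with index I v ∈? G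
      ... | yes v∈G = ⊏-agree (profile3-⊏ at-x at-z tt) (R-G v v∈G)
      ... | no  _   = profile3-agree at-x at-z

    -- G makes a beat b while everybody puts c below a, and c and b are ordered as in R.
    almost⇒decisive-left : Decisive G c b
    almost⇒decisive-left R R-G = agree-⊏ (iia S R c b (λ k∈ → S~R (rep I k∈))) (⊏-trans (h S) c⊏a a⊏b)
      where
      S : Config X V
      S = select I G (const (profile3 1 2 0)) (λ v → profile3 4 2 (suc (toℕ (code (R v) c b))))
      a⊏b : a ⊏[ h S ] b
      a⊏b = ad S in-G out-G
        where
        in-G : ∀ v → index I v ∈ G → a ⊏[ S v ] b
        in-G v v∈G with index I v ∈? G
        ... | yes _    = profile3-⊏ at-x at-y tt
        ... | no  v∉G  = contradiction v∈G v∉G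
        out-G : ∀ v → index I v ∉ G → b ⊏[ S v ] a
        out-G v v∉G with index I v ∈? G
        ... | yes v∈G = contradiction v∈G v∉G
        ... | no  _   = profile3-⊏ at-y at-x tt
      c⊏a : c ⊏[ h S ] a
      c⊏a = wpp S c a c⊏a-everywhere
        where
        c⊏a-everywhere : ∀ v → c ⊏[ S v ] a
        c⊏a-everywhere v with index I v ∈? G
        ... | yes _ = profile3-⊏ at-z at-x tt
        ... | no  _ = profile3-⊏ at-z at-x (rank<4 (code (R v) c b))
      S~R : ∀ v → Agree (S v) (R v) c b
      S~R v with index I v ∈? G
      ... | yes v∈G = ⊏-agree (profile3-⊏ at-z at-y tt) (R-G v v∈G)
      ... | no  _   = profile3-agree at-z at-y

  decisive⇒almost : ∀ {G a b} → Decisive G a b → AlmostDecisive G a b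
  decisive⇒almost d R R-G _ = d R R-G

  almost⇒decisiveForAll : ∀ {G a b} → a ≢ b → AlmostDecisive G a b → DecisiveForAll G
  almost⇒decisiveForAll {G} a≢b ad {s} {t} s≢t with third s t
  ... | w , w≢s , w≢t =
    almost⇒decisive-right (w≢s ∘ sym) (s≢t ∘ sym) (w≢t ∘ sym) (almost-everywhere (w≢s ∘ sym))
    where
    almost-everywhere : ∀ {c d} → c ≢ d → AlmostDecisive G c d
    almost-everywhere = all-pairs (AlmostDecisive G)
      (λ p≢q r≢p r≢q ad′ → decisive⇒almost (almost⇒decisive-right p≢q r≢p r≢q ad′))
      (λ p≢q r≢p r≢q ad′ → decisive⇒almost (almost⇒decisive-left p≢q r≢p r≢q ad′))
      a≢b ad

  open ThreePoints _≟_ x₀≢y₀ x₀≢z₀ y₀≢z₀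

  -- With k ranking x₀ y₀ z₀, the rest of G ranking z₀ x₀ y₀ and the others y₀ z₀ x₀, society
  -- puts x₀ below y₀; where it puts z₀ relative to x₀ decides which part of G is decisive.
  splitting-profile : Coalition → Fin (size I) → Config X V
  splitting-profile G k =
    select I ⁅ k ⁆ (const (profile3 0 1 2)) (select I G (const (profile3 1 2 0)) (const (profile3 2 0 1)))

  contract : ∀ {G k} → DecisiveForAll G → k ∈ G → DecisiveForAll ⁅ k ⁆ ⊎ DecisiveForAll (G - k)
  contract {G} {k} d k∈G with T? (rel (h (splitting-profile G k)) z₀ x₀)
  ... | yes z₀⊑x₀ = inj₂ (almost⇒decisiveForAll (y₀≢z₀ ∘ sym) almost)
    where
    S = splitting-profile G k
    x₀⊏y₀ : x₀ ⊏[ h S ] y₀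
    x₀⊏y₀ = d x₀≢y₀ S in-G
      where
      in-G : ∀ v → index I v ∈ G → x₀ ⊏[ S v ] y₀
      in-G v v∈G with index I v ∈? ⁅ k ⁆ | index I v ∈? G
      ... | yes _ | _     = profile3-⊏ at-x at-y tt
      ... | no  _ | yes _ = profile3-⊏ at-x at-y tt
      ... | no  _ | no v∉G = contradiction v∈G v∉G
    almost : AlmostDecisive (G - k) z₀ y₀
    almost R in-G-k out-G-k = agree-⊏ (iia S R z₀ y₀ (λ k∈ → S~R (rep I k∈))) (⊑-⊏-trans (h S) z₀⊑x₀ x₀⊏y₀)
      where
      S~R : ∀ v → Agree (S v) (R v) z₀ y₀
      S~R v with index I v ∈? ⁅ k ⁆ | index I v ∈? G
      ... | yes v∈⁅k⁆ | _ =
        agree-swap (⊏-agree (profile3-⊏ at-y at-z tt)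
                            (out-G-k v (λ v∈G-k → ∈-⇒≢ G v∈G-k (x∈⁅y⁆⇒x≡y k v∈⁅k⁆))))
      ... | no v∉⁅k⁆ | yes v∈G =
        ⊏-agree (profile3-⊏ at-z at-y tt) (in-G-k v (x∈p∧x≢y⇒x∈p-y v∈G (x∉⁅y⁆⇒x≢y v∉⁅k⁆)))
      ... | no _ | no v∉G =
        agree-swap (⊏-agree (profile3-⊏ at-y at-z tt) (out-G-k v (v∉G ∘ p─q⊆p _ _)))
  ... | no z₀⋢x₀ = inj₁ (almost⇒decisiveForAll x₀≢z₀ almost)
    where
    S = splitting-profile G k
    almost : AlmostDecisive ⁅ k ⁆ x₀ z₀
    almost R in-k out-k = agree-⊏ (iia S R x₀ z₀ (λ k∈ → S~R (rep I k∈))) (⋢⇒⊏ (h S) z₀⋢x₀)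
      where
      S~R : ∀ v → Agree (S v) (R v) x₀ z₀
      S~R v with index I v ∈? ⁅ k ⁆ | index I v ∈? G
      ... | yes v∈⁅k⁆ | _     = ⊏-agree (profile3-⊏ at-x at-z tt) (in-k v v∈⁅k⁆)
      ... | no v∉⁅k⁆  | yes _ = agree-swap (⊏-agree (profile3-⊏ at-z at-x tt) (out-k v v∉⁅k⁆))
      ... | no v∉⁅k⁆  | no  _ = agree-swap (⊏-agree (profile3-⊏ at-z at-x tt) (out-k v v∉⁅k⁆))

  -- The empty coalition is not decisive: indifferent voters would force x₀ below and above y₀.
  decisive-singleton : ∀ m {G} → ∣ G ∣ < m → DecisiveForAll G → ∃ λ k → DecisiveForAll ⁅ k ⁆
  decisive-singleton (suc m) {G} |G|<m d with nonempty? G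
  ... | no  G-empty =
    ⊥-elim (⊏-asym (h R) (d x₀≢y₀ R (λ v → ⊥-elim ∘ ∉G v)) (d (x₀≢y₀ ∘ sym) R (λ v → ⊥-elim ∘ ∉G v)))
    where
    R : Config X V
    R = const indifference
    ∉G : ∀ v → index I v ∉ G
    ∉G v v∈G = G-empty (_ , v∈G)
  ... | yes (k , k∈G) with contract d k∈G
  ...   | inj₁ d⁅k⁆ = k , d⁅k⁆
  ...   | inj₂ dG-k = decisive-singleton m (<-≤-trans (x∈p⇒∣p-x∣<∣p∣ k∈G) (s≤s⁻¹ |G|<m)) dG-k

  decisive-live : ∀ {k} → DecisiveForAll ⁅ k ⁆ → k ∈ live I
  decisive-live {k} d with k ∈? live I
  ... | yes k∈ = k∈
  ... | no  k∉ = ⊥-elim (⊏-asym (h R₂) (agree-⊏ R₁~R₂ (d x₀≢y₀ R₁ R₁-k)) (d (x₀≢y₀ ∘ sym) R₂ R₂-k))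
    where
    R₁ R₂ : Config X V
    R₁ = select I ⁅ k ⁆ (const (profile3 0 1 2)) (const indifference)
    R₂ = select I ⁅ k ⁆ (const (profile3 1 0 2)) (const indifference)
    R₁-k : ∀ v → index I v ∈ ⁅ k ⁆ → x₀ ⊏[ R₁ v ] y₀
    R₁-k v v∈⁅k⁆ with index I v ∈? ⁅ k ⁆
    ... | yes _ = profile3-⊏ at-x at-y tt
    ... | no v∉ = contradiction v∈⁅k⁆ v∉
    R₂-k : ∀ v → index I v ∈ ⁅ k ⁆ → y₀ ⊏[ R₂ v ] x₀
    R₂-k v v∈⁅k⁆ with index I v ∈? ⁅ k ⁆
    ... | yes _ = profile3-⊏ at-y at-x tt
    ... | no v∉ = contradiction v∈⁅k⁆ v∉
    R₁~R₂ : Agree (h R₁) (h R₂) x₀ y₀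
    R₁~R₂ = dead-unconsulted I iia k∉ _ _ _ x₀ y₀

  -- Copy the representative's preference to every voter with index k, so that {k} applies.
  decisive⇒dictator : ∀ {k} → DecisiveForAll ⁅ k ⁆ → (k∈ : k ∈ live I) → DirectDictator h (rep I k∈)
  decisive⇒dictator {k} d k∈ a b R a⊑b with T? (rel (R (rep I k∈)) a b)
  ... | yes a⊑b′ = a⊑b′
  ... | no  a⋢b  = contradiction a⊑b (proj₂ (agree-⊏ (iia S R b a S~R) (d (⊏⇒≢ (R j) b⊏a) S S-k)))
    where
    j = rep I k∈
    b⊏a = ⋢⇒⊏ (R j) a⋢b
    S : Config X V
    S = select I ⁅ k ⁆ (const (R j)) R
    S-k : ∀ v → index I v ∈ ⁅ k ⁆ → b ⊏[ S v ] a
    S-k v v∈⁅k⁆ with index I v ∈? ⁅ k ⁆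
    ... | yes _ = b⊏a
    ... | no v∉ = contradiction v∈⁅k⁆ v∉
    S~R : ∀ {l} (l∈ : l ∈ live I) → Agree (S (rep I l∈)) (R (rep I l∈)) b a
    S~R l∈ = agree-≡ (copy-rep I k∈ R l∈)

  arrow : ∃ (DirectDictator h)
  arrow with decisive-singleton (suc (size I)) (s≤s (∣p∣≤n ⊤)) everyone
    where
    everyone : DecisiveForAll ⊤
    everyone {a} {b} _ R R-all = wpp R a b (λ v → R-all v ∈⊤)
  ... | k , d = rep I (decisive-live d) , decisive⇒dictator d (decisive-live d)

NonImposed : SWF X V → Set
NonImposed {X} {V} h = ∀ (a b : X) → ∃ λ (R : Config X V) → a ⊑[ h R ] b

dual-nonImposed : {h : SWF X V} → IIA h → NonImposed h → NonImposed (dual h)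
dual-nonImposed {h = h} iia ni a b with ni a b
... | R , a⊑b = reversed ∘ R , agree-⊑ (dual-reversed {h = h} iia R a b) a⊑b

module WilsonLemmas (_≟_ : DecidableEquality X) (three : AtLeastThree X) (I : Indexing V)
  {h : SWF X V} (iia : IndexedIIA I h) (ni : NonImposed h) where

  open AtLeastThree three
  open Pairs _≟_ three

  Unanimous : X → X → Config X V → Set
  Unanimous a b R = ∀ v → a ⊏[ R v ] b

  Pareto AntiPareto Neutral : X → X → Set
  Pareto     a b = ∀ R → Unanimous a b R → a ⊏[ h R ] b
  AntiPareto a b = ∀ R → Unanimous a b R → b ⊏[ h R ] a
  Neutral    a b = ∀ R → Unanimous a b R → a ≈[ h R ] b

  AlwaysTied : X → X → Set
  AlwaysTied a b = ∀ R → a ≈[ h R ] b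

  pareto-trichotomy : ∀ {a b} → a ≢ b → Pareto a b ⊎ AntiPareto a b ⊎ Neutral a b
  pareto-trichotomy {a} {b} a≢b = classify (compare (h R₀) a b)
    where
    open TwoPoints _≟_ a≢b
    R₀ : Config X V
    R₀ = const (profile2 1)
    R₀~ : ∀ R → Unanimous a b R → Agree (h R₀) (h R) a b
    R₀~ R unan = iia R₀ R a b (λ _ → ⊏-agree (profile2-⊏ tt) (unan _))
    classify : a ⊏[ h R₀ ] b ⊎ a ≈[ h R₀ ] b ⊎ b ⊏[ h R₀ ] a → Pareto a b ⊎ AntiPareto a b ⊎ Neutral a b
    classify (inj₁ a⊏b)        = inj₁ λ R unan → agree-⊏ (R₀~ R unan) a⊏b
    classify (inj₂ (inj₁ a≈b)) = inj₂ (inj₂ λ R unan → agree-≈ (R₀~ R unan) a≈b)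
    classify (inj₂ (inj₂ b⊏a)) = inj₂ (inj₁ λ R unan → agree-⊏ (agree-swap (R₀~ R unan)) b⊏a)

  invariant⇒tied : ∀ {a b} → (∀ R R′ → Agree (h R) (h R′) a b) → AlwaysTied a b
  invariant⇒tied {a} {b} inv R with ni a b | ni b a
  ... | R₁ , a⊑b | R₂ , b⊑a = agree-⊑ (inv R₁ R) a⊑b , agree-⊑ (agree-swap (inv R₂ R)) b⊑a

  -- b plays the role of a in R′, and the tie between a and b transfers the order of (b , c).
  tied-spread : ∀ {a b c} → a ≢ b → c ≢ a → c ≢ b → AlwaysTied a b → AlwaysTied a c
  tied-spread {a} {b} {c} a≢b c≢a c≢b tied = invariant⇒tied λ R R′ →
      agree-trans (agree-sym (iia (S R R′) R a c (λ _ → profile3-agree at-x at-z)))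
      (agree-trans (tie-transfer (b≈a (S R R′)) (b≈a (S R′ R′))
                      (iia (S R R′) (S R′ R′) b c
                        (λ _ → profile3-same-ranks (≡-trans at-y (sym at-y)) (≡-trans at-z (sym at-z)))))
                   (iia (S R′ R′) R′ a c (λ _ → profile3-agree at-x at-z)))
    where
    open ThreePoints _≟_ a≢b (c≢a ∘ sym) (c≢b ∘ sym)
    S : Config X V → Config X V → Config X V
    S R R′ v = profile3 (suc (toℕ (code (R v) a c))) (suc (toℕ (code (R′ v) a c))) 2
    b≈a : ∀ R → b ≈[ h R ] a
    b≈a R = proj₂ (tied R) , proj₁ (tied R)

  tied⇒null : ∀ {a b} → a ≢ b → AlwaysTied a b → Null h
  tied⇒null a≢b tied R c d with c ≟ d
  ... | yes refl = ⊑-refl (h R) c , ⊑-refl (h R) c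
  ... | no  c≢d  = all-pairs AlwaysTied tied-spread
        (λ p≢q r≢p r≢q t → swap (tied-spread (p≢q ∘ sym) r≢q r≢p (swap t))) a≢b tied c≢d R
    where
    swap : ∀ {p q} → AlwaysTied p q → AlwaysTied q p
    swap t R = proj₂ (t R) , proj₁ (t R)

  -- With a at the bottom, a neutral pair (a , b) makes the order of (b , c) independent of the profile.
  neutral⇒null : ∀ {a b} → a ≢ b → Neutral a b → Null h
  neutral⇒null {a} {b} a≢b neutral with third a b
  ... | c , c≢a , c≢b = tied⇒null (c≢b ∘ sym) (invariant⇒tied λ R R′ →
        agree-trans (agree-sym (S~ R))
          (agree-trans (tie-transfer (neutral (S R) (λ _ → profile3-⊏ at-x at-y tt))
                                     (neutral (S R′) (λ _ → profile3-⊏ at-x at-y tt))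
                         (iia (S R) (S R′) a c
                           (λ _ → ⊏-agree (profile3-⊏ at-x at-z tt) (profile3-⊏ at-x at-z tt))))
                       (S~ R′)))
    where
    open ThreePoints _≟_ a≢b (c≢a ∘ sym) (c≢b ∘ sym)
    S : Config X V → Config X V
    S R v = profile3 0 (suc (toℕ (code (R v) b c))) 2
    S~ : ∀ R → Agree (h (S R)) (h R) b c
    S~ R = iia (S R) R b c (λ _ → profile3-agree at-y at-z)

  null-not-pareto : Null h → ∀ {a b} → a ≢ b → ¬ Pareto a b
  null-not-pareto null {a} {b} a≢b pareto = proj₂ (pareto R (λ _ → profile2-⊏ tt)) (proj₂ (null R a b))
    where
    open TwoPoints _≟_ a≢b
    R : Config X V
    R = const (profile2 1)

  -- Put a at the bottom, and b , c as in a profile R with b ⊑ c.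
  pareto-antiPareto-bottom : ∀ {a b c} → a ≢ b → a ≢ c → b ≢ c → Pareto a b → AntiPareto a c → ⊥
  pareto-antiPareto-bottom {a} {b} {c} a≢b a≢c b≢c pareto anti with ni b c
  ... | R , b⊑c = proj₂ (agree-⊏ (agree-swap S~R) (⊏-trans (h S) c⊏a a⊏b)) b⊑c
    where
    open ThreePoints _≟_ a≢b a≢c b≢c
    S : Config X V
    S v = profile3 0 (suc (toℕ (code (R v) b c))) 2
    S~R : Agree (h S) (h R) b c
    S~R = iia S R b c (λ _ → profile3-agree at-y at-z)
    c⊏a = anti S (λ _ → profile3-⊏ at-x at-z tt)
    a⊏b = pareto S (λ _ → profile3-⊏ at-x at-y tt)

  -- Put a at the top, and b , c as in a profile R with c ⊑ b.
  pareto-antiPareto-top : ∀ {a b c} → a ≢ b → a ≢ c → b ≢ c → Pareto b a → AntiPareto c a → ⊥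
  pareto-antiPareto-top {a} {b} {c} a≢b a≢c b≢c pareto anti with ni c b
  ... | R , c⊑b = proj₂ (agree-⊏ S~R (⊏-trans (h S) b⊏a a⊏c)) c⊑b
    where
    open ThreePoints _≟_ a≢b a≢c b≢c
    S : Config X V
    S v = profile3 4 (suc (toℕ (code (R v) b c))) 2
    S~R : Agree (h S) (h R) b c
    S~R = iia S R b c (λ _ → profile3-agree at-y at-z)
    b⊏a = pareto S (λ v → profile3-⊏ at-y at-x (rank<4 (code (R v) b c)))
    a⊏c = anti S (λ _ → profile3-⊏ at-z at-x tt)

  pareto-everywhere : ∀ {a b} → a ≢ b → Pareto a b → ∀ {c d} → c ≢ d → Pareto c d
  pareto-everywhere = all-pairs Pareto right left
    where
    right : ∀ {p q r} → p ≢ q → r ≢ p → r ≢ q → Pareto p q → Pareto p r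
    right {p} {q} {r} p≢q r≢p r≢q pareto with pareto-trichotomy (r≢p ∘ sym)
    ... | inj₁ pareto′          = pareto′
    ... | inj₂ (inj₁ anti)      = ⊥-elim (pareto-antiPareto-bottom p≢q (r≢p ∘ sym) (r≢q ∘ sym) pareto anti)
    ... | inj₂ (inj₂ neutral)   = ⊥-elim (null-not-pareto (neutral⇒null (r≢p ∘ sym) neutral) p≢q pareto)
    left : ∀ {p q r} → p ≢ q → r ≢ p → r ≢ q → Pareto p q → Pareto r q
    left {p} {q} {r} p≢q r≢p r≢q pareto with pareto-trichotomy r≢q
    ... | inj₁ pareto′          = pareto′
    ... | inj₂ (inj₁ anti)      =
      ⊥-elim (pareto-antiPareto-top (p≢q ∘ sym) (r≢q ∘ sym) (r≢p ∘ sym) pareto anti)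
    ... | inj₂ (inj₂ neutral)   = ⊥-elim (null-not-pareto (neutral⇒null r≢q neutral) p≢q pareto)

  -- For x = y the unanimity hypothesis is absurd unless there are no voters, and then the
  -- profile is irrelevant: society would put a strictly below and above b.
  pareto⇒wpp : ∀ {a b} → a ≢ b → Pareto a b → WPP h
  pareto⇒wpp {a} {b} a≢b pareto R x y unan with x ≟ y
  ... | no  x≢y  = pareto-everywhere a≢b pareto x≢y R unan
  ... | yes refl =
    ⊥-elim (⊏-asym (h R) (pareto R absurd) (pareto-everywhere a≢b pareto (a≢b ∘ sym) R absurd))
    where
    absurd : ∀ {p q} v → p ⊏[ R v ] q
    absurd v = ⊥-elim (⊏-asym (R v) (unan v) (unan v))

wilson : DecidableEquality X → AtLeastThree X → (I : Indexing V) {h : SWF X V} →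
  IndexedIIA I h → NonImposed h → Null h ⊎ Dictatorial h
wilson {X} {V} _≟_ three I {h} iia ni = by-pareto (W.pareto-trichotomy x₀≢y₀)
  where
  open AtLeastThree three
  module W = WilsonLemmas _≟_ three I iia ni
  iiaᵈ : IndexedIIA I (dual h)
  iiaᵈ = dual-indexedIIA I {h = h} iia
  module W′ = WilsonLemmas _≟_ three I iiaᵈ (dual-nonImposed {h = h} (indexedIIA⇒IIA I {h = h} iia) ni)
  by-pareto : W.Pareto x₀ y₀ ⊎ W.AntiPareto x₀ y₀ ⊎ W.Neutral x₀ y₀ → Null h ⊎ Dictatorial h
  by-pareto (inj₁ pareto) =
    inj₂ (map₂ inj₁ (Arrow.arrow _≟_ three I iia (W.pareto⇒wpp x₀≢y₀ pareto)))
  by-pareto (inj₂ (inj₁ anti)) =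
    inj₂ (map₂ (inj₂ ∘ dual-direct⇒inverse {h = h} (indexedIIA⇒IIA I {h = h} iia))
      (Arrow.arrow _≟_ three I iiaᵈ (W′.pareto⇒wpp (x₀≢y₀ ∘ sym) (anti ∘ (reversed ∘_)))))
  by-pareto (inj₂ (inj₂ neutral)) = inj₁ (W.neutral⇒null x₀≢y₀ neutral)

module _ (I : Indexing V) where

  -- Voters take the preference of the remaining representative of their index; those sharing
  -- the index of j become indifferent.
  restore : (j : V) → Config X (V ∖[ j ]) → Config X V
  restore j R v = at (index I v ∈? live (I ∖ᵢ j))
    where
    at : ∀ {k} → Dec (k ∈ live (I ∖ᵢ j)) → Pref _
    at (yes k∈) = R (rep (I ∖ᵢ j) k∈)
    at (no  _)  = indifference

  defer : SWF X V → (j : V) → SWF X (V ∖[ j ])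
  defer h j = h ∘ restore j

  live-shrinks : ∀ {j} → index I j ∈ live I → ∣ live (I ∖ᵢ j) ∣ < ∣ live I ∣
  live-shrinks = x∈p⇒∣p-x∣<∣p∣

  module _ {h : SWF X V} (iia : IndexedIIA I h) where

    defer-indexedIIA : ∀ j → IndexedIIA (I ∖ᵢ j) (defer h j)
    defer-indexedIIA j P Q x y P~Q = iia _ _ x y restored
      where
      restored : ∀ {l} (l∈ : l ∈ live I) → Agree (restore j P (rep I l∈)) (restore j Q (rep I l∈)) x y
      restored l∈ with index I (rep I l∈) ∈? live (I ∖ᵢ j)
      ... | yes m∈ = P~Q m∈
      ... | no  _  = agree-refl

    -- Strict preferences of j decide, so by indexed IIA the index of j must be live.
    direct-dictator-live : DecidableEquality X → ∀ {j a b} → DirectDictator h j → a ≢ b → index I j ∈ live I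
    direct-dictator-live _≟_ {j} {a} {b} dd a≢b with index I j ∈? live I
    ... | yes j∈ = j∈
    ... | no  j∉ = ⊥-elim (⊏-asym (h R₂)
      (agree-⊏ (dead-unconsulted I iia j∉ _ _ _ a b) (dictator-⊏ {h = h} dd R₁ a⊏b))
      (dictator-⊏ {h = h} dd R₂ b⊏a))
      where
      open TwoPoints _≟_ a≢b
      R₁ R₂ : Config X V
      R₁ = select I ⁅ index I j ⁆ (const (profile2 1)) (const indifference)
      R₂ = select I ⁅ index I j ⁆ (const (profile2 3)) (const indifference)
      a⊏b : a ⊏[ R₁ j ] b
      a⊏b = subst (λ P → a ⊏[ P ] b) (sym (select-own I _ _ j)) (profile2-⊏ tt)
      b⊏a : b ⊏[ R₂ j ] a
      b⊏a = subst (λ P → b ⊏[ P ] a) (sym (select-own I _ _ j)) (profile2-⊐ tt)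

    -- Untying j while leaving the representative c of its index strict would make j and c
    -- dictate opposite strict orders on profiles that agree at the representatives.
    dictator-tie⇒rep-not-strict : DecidableEquality X → ∀ {j} → DirectDictator h j →
      (j∈ : index I j ∈ live I) → ∀ R {a b} → a ≈[ R j ] b → ¬ a ⊏[ R (rep I j∈) ] b
    dictator-tie⇒rep-not-strict _≟_ {j} dd j∈ R {a} {b} a≈b a⊏b =
      ⊏-asym (h R₂) (dictator-⊏ {h = h} dd R₂ a⊏b′)
                    (agree-⊏ (agree-swap R₁~R₂) (dictator-⊏ {h = h} dd R₁ b⊏a))
      where
      a≢b : a ≢ b
      a≢b = ⊏⇒≢ (R (rep I j∈)) a⊏b
      open TwoPoints _≟_ a≢b
      k = index I j
      R₁ R₂ : Config X V
      R₁ = select I ⁅ k ⁆ (untie ∘ R) R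
      R₂ = select I ⁅ k ⁆ (const (R (rep I j∈))) R
      b⊏a : b ⊏[ R₁ j ] a
      b⊏a = subst (λ P → b ⊏[ P ] a) (sym (select-own I (untie ∘ R) R j)) (untie-≈ {R j} a≈b)
      a⊏b′ : a ⊏[ R₂ j ] b
      a⊏b′ = subst (λ P → a ⊏[ P ] b) (sym (select-own I (const (R (rep I j∈))) R j)) a⊏b
      R₁~R : ∀ {l} (l∈ : l ∈ live I) → R₁ (rep I l∈) ≡ R (rep I l∈)
      R₁~R l∈ with index I (rep I l∈) ∈? ⁅ k ⁆
      ... | no  _    = refl
      ... | yes ∈⁅k⁆ = untie-⊏ {R (rep I l∈)} (subst (λ v → a ⊏[ R v ] b) c≡rep a⊏b)
        where
        c≡rep : rep I j∈ ≡ rep I l∈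
        c≡rep = rep-cong I (≡-trans (sym (x∈⁅y⁆⇒x≡y k ∈⁅k⁆)) (index-rep I l∈)) j∈ l∈
      R₁~R₂ : Agree (h R₁) (h R₂) a b
      R₁~R₂ = iia R₁ R₂ a b λ l∈ → agree-≡ (≡-trans (R₁~R l∈) (sym (copy-rep I j∈ R l∈)))

    dictator-rep-tie : DecidableEquality X → ∀ {j} → DirectDictator h j → (j∈ : index I j ∈ live I) →
      ∀ R {a b} → a ≈[ R j ] b → a ≈[ R (rep I j∈) ] b
    dictator-rep-tie _≟_ dd j∈ R {a} {b} a≈b with compare (R (rep I j∈)) a b
    ... | inj₂ (inj₁ a≈′b) = a≈′b
    ... | inj₁ a⊏b         = ⊥-elim (dictator-tie⇒rep-not-strict _≟_ dd j∈ R a≈b a⊏b)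
    ... | inj₂ (inj₂ b⊏a)  = ⊥-elim (dictator-tie⇒rep-not-strict _≟_ dd j∈ R (proj₂ a≈b , proj₁ a≈b) b⊏a)

    defer-agree : DecidableEquality X → ∀ {j} → DirectDictator h j → ∀ R {a b} → a ≢ b → a ≈[ R j ] b →
      Agree (h R) (defer h j (drop j R)) a b
    defer-agree _≟_ {j} dd R {a} {b} a≢b a≈b = iia _ _ a b same
      where
      j∈ = direct-dictator-live _≟_ dd a≢b
      same : ∀ {l} (l∈ : l ∈ live I) → Agree (R (rep I l∈)) (restore j (drop j R) (rep I l∈)) a b
      same {l} l∈ with index I (rep I l∈) ∈? live (I ∖ᵢ j)
      ... | yes m∈ = agree-≡ (cong R (rep-cong I (sym (index-rep I l∈)) l∈ (p─q⊆p _ _ m∈)))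
      ... | no  m∉ =
        ≈-agree (subst (λ v → a ≈[ R v ] b) (rep-cong I j≡l j∈ l∈) (dictator-rep-tie _≟_ dd j∈ R a≈b))
                (tt , tt)
        where
        j≡l : index I j ≡ l
        j≡l = ≡-trans (sym (removed-index I (subst (_∈ live I) (sym (index-rep I l∈)) l∈) m∉))
                      (index-rep I l∈)

  dictator-live : DecidableEquality X → {h : SWF X V} → IndexedIIA I h → ∀ {j a b} → Dictator h j → a ≢ b →
    index I j ∈ live I
  dictator-live _≟_ iia (inj₁ dd)  = direct-dictator-live iia _≟_ dd
  dictator-live _≟_ {h} iia (inj₂ inv) =
    direct-dictator-live (dual-indexedIIA I {h = h} iia) _≟_ (inverse⇒dual-direct {h = h} inv)

  restore-reversed : ∀ j (R : Config X (V ∖[ j ])) v {x y} →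
    Agree (reversed (restore j (reversed ∘ R) v)) (restore j R v) x y
  restore-reversed j R v with index I v ∈? live (I ∖ᵢ j)
  ... | yes _ = agree-refl
  ... | no  _ = agree-refl

  defers : DecidableEquality X → {h : SWF X V} → IndexedIIA I h → ∀ {j} → Dictator h j →
    Defers h j (defer h j)
  defers _≟_ {h} iia {j} d x y R x≈y with x ≟ y
  ... | yes refl = mk⇔ (λ _ → ⊑-refl (defer h j (drop j R)) x) (λ _ → ⊑-refl (h R) x)
  ... | no  x≢y  = agree-⇔ (by-dictator d)
    where
    by-dictator : Dictator h j → Agree (h R) (defer h j (drop j R)) x y
    by-dictator (inj₁ dd)  = defer-agree iia _≟_ dd R x≢y x≈y
    by-dictator (inj₂ inv) =
      agree-trans (dual-reversed {h = h} (indexedIIA⇒IIA I {h = h} iia) R x y)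
        (agree-trans (defer-agree (dual-indexedIIA I {h = h} iia) _≟_ (inverse⇒dual-direct {h = h} inv)
                        (reversed ∘ R) x≢y (proj₂ x≈y , proj₁ x≈y))
                     (iia _ _ x y (λ _ → restore-reversed j (drop j R) _)))

extRel'-in : ∀ {b c} (k : T b → T c → Bool) (tb : T b) (tc : T c) → extRel' b c k ≡ k tb tc
extRel'-in {true} {true} k _ _ = refl

module _ {p : X → Bool} where

  sub-≟ : DecidableEquality X → DecidableEquality (Sub p)
  sub-≟ _≟_ (x , px) (y , py) with x ≟ y
  ... | yes refl = yes (cong (x ,_) (T-irrelevant px py))
  ... | no  x≢y  = no (x≢y ∘ cong proj₁)

  module _ {x y : X} (px : T (p x)) (py : T (p y)) where

    extend-agree : {R R′ : Pref (Sub p)} → Agree R R′ (x , px) (y , py) →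
      Agree (extendPref p R) (extendPref p R′) x y
    extend-agree (agree e₁ e₂) =
      agree (≡-trans (extRel'-in _ px py) (≡-trans e₁ (sym (extRel'-in _ px py))))
            (≡-trans (extRel'-in _ py px) (≡-trans e₂ (sym (extRel'-in _ py px))))

    extend-restrict : (P : Pref X) → Agree (extendPref p (restrictPref p P)) P x y
    extend-restrict P = agree (extRel'-in _ px py) (extRel'-in _ py px)

  restrict-indexedIIA : (I : Indexing V) {g : SWF X V} → IndexedIIA I g → IndexedIIA I (restrictSWF g p)
  restrict-indexedIIA I iia P Q (x , px) (y , py) P~Q =
    let a = iia _ _ x y (λ k∈ → extend-agree px py (P~Q k∈)) in agree (≡-forth a) (≡-back a)

  IIA⇒restrictionWellDefined : {g : SWF X V} → IIA g → RestrictionWellDefined g p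
  IIA⇒restrictionWellDefined iia P Q P~Q x y px py = iia P Q x y (λ v → P~Q v x y px py)

  restriction-agree : {g : SWF X V} → RestrictionWellDefined g p → ∀ {x y} → T (p x) → T (p y) →
    (P : Config X V) → Agree (g P) (g (extendPref p ∘ restrictPref p ∘ P)) x y
  restriction-agree wd {x} {y} px py P =
    toAgree (wd P _ (λ v z w pz pw → fromAgree (agree-sym (extend-restrict pz pw (P v)))) x y px py)

Enumeration : Set → Set
Enumeration X = Σ (List X) λ xs → ∀ x → x ∈ˡ xs

∃? : Enumeration X → {P : X → Set} → (∀ x → Dec (P x)) → Dec (∃ P)
∃? (xs , complete) P? =
  map′ (λ any → let x , _ , Px = find any in x , Px) (λ (x , Px) → lose (complete x) Px) (any? P? xs)

module _ (p : X → Bool) where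

  subList : List X → List (Sub p)
  subList []       = []
  subList (x ∷ xs) with T? (p x)
  ... | yes px = (x , px) ∷ subList xs
  ... | no  _  = subList xs

  ∈-subList : ∀ {x xs} (px : T (p x)) → x ∈ˡ xs → (x , px) ∈ˡ subList xs
  ∈-subList {x} px (here refl) with T? (p x)
  ... | yes px′ = here (cong (x ,_) (T-irrelevant px px′))
  ... | no  ¬px = contradiction px ¬px
  ∈-subList {xs = x′ ∷ _} px (there x∈) with T? (p x′)
  ... | yes _ = there (∈-subList px x∈)
  ... | no  _ = ∈-subList px x∈

  sub-enumeration : Enumeration X → Enumeration (Sub p)
  sub-enumeration (xs , complete) = subList xs , λ (x , px) → ∈-subList px (complete x)

data SizeCases (X : Set) : Set where
  atLeastThree : AtLeastThree X → SizeCases X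
  exactlyTwo   : ExactlyTwo X → SizeCases X
  subsingleton : (∀ (x y : X) → x ≡ y) → SizeCases X

size-cases : DecidableEquality X → Enumeration X → SizeCases X
size-cases _≟_ e with ∃? e (λ a → ∃? e (λ b → ∃? e (λ c → ¬? (a ≟ b) ×-dec ¬? (a ≟ c) ×-dec ¬? (b ≟ c))))
... | yes (_ , _ , _ , a≢b , a≢c , b≢c) = atLeastThree (distinct3 a≢b a≢c b≢c)
... | no  no-three with ∃? e (λ a → ∃? e (λ b → ¬? (a ≟ b)))
...   | yes (a , b , a≢b) = exactlyTwo (a , b , a≢b , a-or-b)
  where
  a-or-b : ∀ z → z ≡ a ⊎ z ≡ b
  a-or-b z with z ≟ a | z ≟ b
  ... | yes z≡a | _       = inj₁ z≡a
  ... | no  _   | yes z≡b = inj₂ z≡b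
  ... | no  z≢a | no  z≢b = ⊥-elim (no-three (a , b , z , a≢b , z≢a ∘ sym , z≢b ∘ sym))
...   | no  no-two = subsingleton λ x y → decidable-stable (x ≟ y) (λ x≢y → no-two (x , y , x≢y))

subsingleton-null : {h : SWF X V} → (∀ (x y : X) → x ≡ y) → Null h
subsingleton-null {h = h} single R x y =
  subst (λ z → x ≈[ h R ] z) (single x y) (⊑-refl (h R) x , ⊑-refl (h R) x)

exactlyTwo⇒atMostTwo : ExactlyTwo X → AtMostTwo X
exactlyTwo⇒atMostTwo (a , b , a≢b , a-or-b) x y z with a-or-b x | a-or-b y | a-or-b z
... | inj₁ refl | inj₁ refl | _         = inj₁ refl
... | inj₂ refl | inj₂ refl | _         = inj₁ refl
... | _         | inj₁ refl | inj₁ refl = inj₂ (inj₁ refl)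
... | _         | inj₂ refl | inj₂ refl = inj₂ (inj₁ refl)
... | inj₁ refl | _         | inj₁ refl = inj₂ (inj₂ refl)
... | inj₂ refl | _         | inj₂ refl = inj₂ (inj₂ refl)

∃-vector? : ∀ {m} n {P : Vec (Fin m) n → Set} → (∀ q → Dec (P q)) → Dec (∃ P)
∃-vector? zero    P? = map′ ([] ,_) (λ { ([] , Pq) → Pq }) (P? [])
∃-vector? (suc n) P? = map′ (λ (c , q , Pq) → c ∷ q , Pq) (λ { (c ∷ q , Pq) → c , q , Pq })
  (any?ᶠ λ c → ∃-vector? n (P? ∘ (c ∷_)))

module Cleric (_≟_ : DecidableEquality X) (I : Indexing V) {g : SWF X V} (iia : IndexedIIA I g) where

  -- Every voter puts x below, level with or above everything else, according to the code of its index.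
  coded : X → Vec (Fin 3) (size I) → Config X V
  coded x q v = singled _≟_ x (suc (toℕ (lookup q (index I v))))

  -- By indexed IIA, x ⊑ y in some g R iff x ⊑ y in some g (coded x q): a finite search.
  coded? : ∀ x y → Dec (∃ λ q → x ⊑[ g (coded x q) ] y)
  coded? x y = ∃-vector? (size I) λ q → T? (rel (g (coded x q)) x y)

  rel-cleric : X → X → Bool
  rel-cleric x y = ⌊ coded? x y ⌋

  cleric-sound : ∀ {x y} → T (rel-cleric x y) → ∃ λ R → x ⊑[ g R ] y
  cleric-sound {x} {y} t = let q , x⊑y = toWitness {a? = coded? x y} t in coded x q , x⊑y

  cleric-complete : ∀ {x y} R → x ⊑[ g R ] y → T (rel-cleric x y)
  cleric-complete {x} {y} R x⊑y with x ≟ y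
  ... | yes refl = fromWitness {a? = coded? x x} (replicate _ zero , ⊑-refl (g _) x)
  ... | no  x≢y  = fromWitness {a? = coded? x y} (codes , agree-⊑ (iia R (coded x codes) x y R~coded) x⊑y)
    where
    open TwoPoints _≟_ x≢y
    codeAt : ∀ {k} → Dec (k ∈ live I) → Fin 3
    codeAt (yes k∈) = code (R (rep I k∈)) x y
    codeAt (no  _)  = zero
    codes : Vec (Fin 3) (size I)
    codes = tabulate (λ k → codeAt (k ∈? live I))
    codes-at-rep : ∀ {l} (l∈ : l ∈ live I) → lookup codes (index I (rep I l∈)) ≡ code (R (rep I l∈)) x y
    codes-at-rep l∈ = ≡-trans (lookup∘tabulate (λ k → codeAt (k ∈? live I)) (index I (rep I l∈)))
                             (codeAt-rep (index I (rep I l∈) ∈? live I))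
      where
      codeAt-rep : (d : Dec (index I (rep I l∈) ∈ live I)) → codeAt d ≡ code (R (rep I l∈)) x y
      codeAt-rep (yes m∈) = cong (λ v → code (R v) x y) (rep-cong I (index-rep I l∈) m∈ l∈)
      codeAt-rep (no  m∉) = contradiction (subst (_∈ live I) (sym (index-rep I l∈)) l∈) m∉
    R~coded : ∀ {l} (l∈ : l ∈ live I) → Agree (R (rep I l∈)) (coded x codes (rep I l∈)) x y
    R~coded l∈ =
      agree-sym (agree-trans (agree-≡ (cong (profile2 ∘ suc ∘ toℕ) (codes-at-rep l∈)))
                             (profile2-agree (R (rep I l∈))))

  cleric-total : ∀ x y → T (rel-cleric x y) ⊎ T (rel-cleric y x)
  cleric-total x y = Sum.map (cleric-complete R₀) (cleric-complete R₀) (total (g R₀) x y)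
    where
    R₀ : Config X V
    R₀ = const indifference

  -- Profiles witnessing x ⊑ y and y ⊑ z are merged by IIA into one witnessing both.
  cleric-trans : ∀ x y z → T (rel-cleric x y) → T (rel-cleric y z) → T (rel-cleric x z)
  cleric-trans x y z xy yz with x ≟ y | y ≟ z | x ≟ z
  ... | yes refl | _        | _        = yz
  ... | no  _    | yes refl | _        = xy
  ... | no  _    | no  _    | yes refl = cleric-complete (const indifference) (⊑-refl (g _) x)
  ... | no  x≢y  | no  y≢z  | no  x≢z  =
    cleric-complete S
      (trans (g S) x y z (agree-⊑ R₁~S (proj₂ (cleric-sound xy))) (agree-⊑ R₂~S (proj₂ (cleric-sound yz))))
    where
    open ThreePoints _≟_ x≢y x≢z y≢z
    R₁ R₂ S : Config X V
    R₁ = proj₁ (cleric-sound xy)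
    R₂ = proj₁ (cleric-sound yz)
    S v = profile3 (suc (toℕ (code (R₁ v) x y))) 2 (suc (toℕ (code (R₂ v) z y)))
    R₁~S : Agree (g R₁) (g S) x y
    R₁~S = iia R₁ S x y (λ _ → agree-sym (profile3-agree at-x at-y))
    R₂~S : Agree (g R₂) (g S) y z
    R₂~S = agree-swap (iia R₂ S z y (λ _ → agree-sym (profile3-agree at-z at-y)))

  cleric : Pref X
  rel   cleric = rel-cleric
  total cleric = cleric-total
  trans cleric = cleric-trans

  clerical : Clerical g cleric
  clerical x y = cleric-complete

  class-nonImposed : ∀ a → NonImposed (restrictSWF g (classOf cleric a))
  class-nonImposed a (x , x≈a) (y , y≈a) =
    restrictPref A ∘ R , agree-⊑ (restriction-agree {g = g} wd x≈a y≈a R) x⊑y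
    where
    A = classOf cleric a
    wd : RestrictionWellDefined g A
    wd = IIA⇒restrictionWellDefined {p = A} {g = g} (indexedIIA⇒IIA I {h = g} iia)
    x⊑a = proj₁ (Equivalence.to T-∧ x≈a)
    a⊑y = proj₂ (Equivalence.to T-∧ y≈a)
    R = proj₁ (cleric-sound (cleric-trans x a y x⊑a a⊑y))
    x⊑y = proj₂ (cleric-sound (cleric-trans x a y x⊑a a⊑y))

clericalDictatorial : ∀ m → DecidableEquality X → Enumeration X → (I : Indexing V) {g : SWF X V} →
  IndexedIIA I g → ∣ live I ∣ < m → ClericalDictatorial X V g
clericalDictatorial {X} {V} (suc m) _≟_ e I {g} iia live<m = cd-cleric cleric clerical restriction deferral
  where
  open Cleric _≟_ I iia
  A : X → X → Bool
  A = classOf cleric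
  hA : ∀ a → SWF (Sub (A a)) V
  hA a = restrictSWF g (A a)
  iiaA : ∀ a → IndexedIIA I (hA a)
  iiaA a = restrict-indexedIIA I {g = g} iia
  class-size : ∀ a → SizeCases (Sub (A a))
  class-size a = size-cases (sub-≟ _≟_) (sub-enumeration (A a) e)

  restriction : ∀ a →
    RestrictionWellDefined g (A a) × (Null (hA a) ⊎ Dictatorial (hA a) ⊎ ExactlyTwo (Sub (A a)))
  restriction a =
    IIA⇒restrictionWellDefined {p = A a} {g = g} (indexedIIA⇒IIA I {h = g} iia) , by-size (class-size a)
    where
    by-size : SizeCases (Sub (A a)) → Null (hA a) ⊎ Dictatorial (hA a) ⊎ ExactlyTwo (Sub (A a))
    by-size (atLeastThree three) = Sum.map₂ inj₁ (wilson (sub-≟ _≟_) three I (iiaA a) (class-nonImposed a))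
    by-size (exactlyTwo two)     = inj₂ (inj₂ two)
    by-size (subsingleton single) = inj₁ (subsingleton-null {h = hA a} single)

  deferral : ∀ a j → Dictator (hA a) j →
    Σ (SWF (Sub (A a)) (V ∖[ j ])) λ g′ → Defers (hA a) j g′ × ClericalDictatorial (Sub (A a)) (V ∖[ j ]) g′
  deferral a j d = defer I (hA a) j , defers I (sub-≟ _≟_) (iiaA a) d , by-size (class-size a)
    where
    by-size : SizeCases (Sub (A a)) → ClericalDictatorial (Sub (A a)) (V ∖[ j ]) (defer I (hA a) j)
    by-size (atLeastThree three) =
      clericalDictatorial m (sub-≟ _≟_) (sub-enumeration (A a) e) (I ∖ᵢ j) (defer-indexedIIA I (iiaA a) j)
        (<-≤-trans (live-shrinks I (dictator-live I (sub-≟ _≟_) (iiaA a) d (AtLeastThree.x₀≢y₀ three)))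
                   (s≤s⁻¹ live<m))
    by-size (exactlyTwo two)      = cd-small (exactlyTwo⇒atMostTwo two)
    by-size (subsingleton single) = cd-small λ x y _ → inj₁ (single x y)

defers-agree : {h : SWF X V} {j : V} {g : SWF X (V ∖[ j ])} → Defers h j g → (R : Config X V) →
  x ≈[ R j ] y → Agree (h R) (g (drop j R)) x y
defers-agree {x = x} {y} defers R (x⊑y , y⊑x) =
  ⇔-agree (defers x y R (x⊑y , y⊑x)) (defers y x R (y⊑x , x⊑y))

-- Strict preferences of the dictator are followed, and its ties are resolved by g.
dictator-defers-IIA : {h : SWF X V} {j : V} {g : SWF X (V ∖[ j ])} →
  Dictator h j → Defers h j g → IIA g → IIA h
dictator-defers-IIA {h = h} {j} {g} d defers iia P Q x y P~Q = fromAgree (by-dictator (compare (P j) x y))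
  where
  P~Qʲ : Agree (P j) (Q j) x y
  P~Qʲ = toAgree (P~Q j)
  by-dictator : x ⊏[ P j ] y ⊎ x ≈[ P j ] y ⊎ y ⊏[ P j ] x → Agree (h P) (h Q) x y
  by-dictator (inj₁ x⊏y)        = dictator-⊏-agree d P Q x⊏y (agree-⊏ P~Qʲ x⊏y)
  by-dictator (inj₂ (inj₂ y⊏x)) = agree-swap (dictator-⊏-agree d P Q y⊏x (agree-⊏ (agree-swap P~Qʲ) y⊏x))
  by-dictator (inj₂ (inj₁ x≈y)) =
    agree-trans (defers-agree {h = h} {g = g} defers P x≈y)
      (agree-trans (iia-agree {h = g} iia (drop j P) (drop j Q) x y (λ w → toAgree (P~Q (proj₁ w))))
                   (agree-sym (defers-agree {h = h} {g = g} defers Q (agree-≈ P~Qʲ x≈y))))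

null⇒IIA : {g : SWF X V} → Null g → IIA g
null⇒IIA {g = g} null P Q x y _ = fromAgree (≈-agree {P = g P} {Q = g Q} (null P x y) (null Q x y))

restriction-IIA : {g : SWF X V} {A : X → Bool} →
  Null (restrictSWF g A) ⊎ Dictatorial (restrictSWF g A) ⊎ ExactlyTwo (Sub A) →
  (∀ j → Dictator (restrictSWF g A) j →
    AtMostTwo (Sub A) ⊎ Σ (SWF (Sub A) (V ∖[ j ])) λ g′ → Defers (restrictSWF g A) j g′ × IIA g′) →
  AtMostTwo (Sub A) ⊎ IIA (restrictSWF g A)
restriction-IIA {g = g} {A} (inj₁ null) _ = inj₂ (null⇒IIA {g = restrictSWF g A} null)
restriction-IIA (inj₂ (inj₂ two))  _         = inj₁ (exactlyTwo⇒atMostTwo two)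
restriction-IIA {g = g} {A} (inj₂ (inj₁ (j , d))) deferral with deferral j d
... | inj₁ two                 = inj₁ two
... | inj₂ (g′ , defers , iia) = inj₂ (dictator-defers-IIA {h = restrictSWF g A} {g = g′} d defers iia)

restriction-agree-pair : DecidableEquality X → {g : SWF X V} {p : X → Bool} → RestrictionWellDefined g p →
  AtMostTwo (Sub p) ⊎ IIA (restrictSWF g p) → ∀ {x y} → T (p x) → T (p y) →
  (P Q : Config X V) → (∀ v → Agree (P v) (Q v) x y) →
  Agree (g P) (g Q) x y
restriction-agree-pair _≟_ {g} {p} wd (inj₁ two) {x} {y} px py P Q P~Q with x ≟ y
... | yes refl = agree-diag (g P) (g Q) x
... | no  x≢y  = toAgree (wd P Q on-subset x y px py)
  where
  x-or-y : ∀ {z} → T (p z) → z ≡ x ⊎ z ≡ y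
  x-or-y {z} pz with two (x , px) (y , py) (z , pz)
  ... | inj₁ x≡y        = ⊥-elim (x≢y (cong proj₁ x≡y))
  ... | inj₂ (inj₁ y≡z) = inj₂ (sym (cong proj₁ y≡z))
  ... | inj₂ (inj₂ x≡z) = inj₁ (sym (cong proj₁ x≡z))
  on-subset : ∀ v z w → T (p z) → T (p w) → AgreeOn (P v) (Q v) z w
  on-subset v z w pz pw with x-or-y pz | x-or-y pw
  ... | inj₁ refl | inj₁ refl = fromAgree (agree-diag (P v) (Q v) x)
  ... | inj₂ refl | inj₂ refl = fromAgree (agree-diag (P v) (Q v) y)
  ... | inj₁ refl | inj₂ refl = fromAgree (P~Q v)
  ... | inj₂ refl | inj₁ refl = fromAgree (agree-swap (P~Q v))

restriction-agree-pair _≟_ {g} {p} wd (inj₂ iia) {x} {y} px py P Q P~Q =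
  agree-trans (restriction-agree {g = g} wd px py P)
    (agree-trans (agree (≡-forth restricted) (≡-back restricted))
                 (agree-sym (restriction-agree {g = g} wd px py Q)))
  where
  restricted =
    iia-agree {h = restrictSWF g p} iia (restrictPref p ∘ P) (restrictPref p ∘ Q) (x , px) (y , py)
                 (λ v → agree (≡-forth (P~Q v)) (≡-back (P~Q v)))

clericalDictatorial⇒IIA : DecidableEquality X → {g : SWF X V} → ClericalDictatorial X V g →
  AtMostTwo X ⊎ IIA g
clericalDictatorial⇒IIA _≟_ {g} (cd-null null) = inj₂ (null⇒IIA {g = g} null)
clericalDictatorial⇒IIA _≟_ (cd-small two) = inj₁ two
clericalDictatorial⇒IIA {X} {V} _≟_ {g} (cd-cleric C clerical restrictions deferrals) =
  inj₂ λ P Q x y P~Q → fromAgree (by-cleric (compare C x y) P Q (toAgree ∘ P~Q))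
  where
  by-cleric : ∀ {x y} → x ⊏[ C ] y ⊎ x ≈[ C ] y ⊎ y ⊏[ C ] x → (P Q : Config X V) →
    (∀ v → Agree (P v) (Q v) x y) → Agree (g P) (g Q) x y
  by-cleric (inj₁ (_ , y⋢x)) P Q _ =
    ⊏-agree (⋢⇒⊏ (g P) (y⋢x ∘ clerical _ _ P)) (⋢⇒⊏ (g Q) (y⋢x ∘ clerical _ _ Q))
  by-cleric (inj₂ (inj₂ (_ , x⋢y))) P Q _ =
    agree-swap (⊏-agree (⋢⇒⊏ (g P) (x⋢y ∘ clerical _ _ P)) (⋢⇒⊏ (g Q) (x⋢y ∘ clerical _ _ Q)))
  by-cleric {x} {y} (inj₂ (inj₁ (x⊑y , y⊑x))) =
    restriction-agree-pair _≟_ {g = g} (proj₁ (restrictions x))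
      (restriction-IIA {g = g} (proj₂ (restrictions x)) deferral)
      (Equivalence.from T-∧ (⊑-refl C x , ⊑-refl C x)) (Equivalence.from T-∧ (y⊑x , x⊑y))
    where
    A = classOf C x
    deferral : ∀ j → Dictator (restrictSWF g A) j →
      AtMostTwo (Sub A) ⊎ Σ (SWF (Sub A) (V ∖[ j ])) λ g′ → Defers (restrictSWF g A) j g′ × IIA g′
    deferral j d = let g′ , defers , cd = deferrals x j d in
      Sum.map₂ (λ iia → g′ , defers , iia) (clericalDictatorial⇒IIA (sub-≟ _≟_) cd)

finIndexing : (N : ℕ) → Indexing (Fin N)
size      (finIndexing N)   = N
index     (finIndexing N)   = id
live      (finIndexing N)   = ⊤
rep       (finIndexing N) {k} _ = k
index-rep (finIndexing N) _ = refl

IIA⇒indexedIIA : ∀ {N} {f : SWF X (Fin N)} → IIA f → IndexedIIA (finIndexing N) f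
IIA⇒indexedIIA {f = f} iia P Q x y P~Q = iia-agree {h = f} iia P Q x y (λ v → P~Q (∈⊤ {x = v}))

fin-enumeration : ∀ n → Enumeration (Fin n)
fin-enumeration n = allFin n , ∈-allFin

fin-three : ∀ m → AtLeastThree (Fin (3 + m))
fin-three m = distinct3 {x₀ = zero} {y₀ = suc zero} {z₀ = suc (suc zero)} (λ ()) (λ ()) (λ ())

atLeastThree⇒¬atMostTwo : AtLeastThree X → ¬ AtMostTwo X
atLeastThree⇒¬atMostTwo (distinct3 x₀≢y₀ x₀≢z₀ y₀≢z₀) two with two _ _ _
... | inj₁ x₀≡y₀        = x₀≢y₀ x₀≡y₀
... | inj₂ (inj₁ y₀≡z₀) = y₀≢z₀ y₀≡z₀
... | inj₂ (inj₂ x₀≡z₀) = x₀≢z₀ x₀≡z₀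

theorem4 : (n N : ℕ) → 3 ≤ n → (f : SWF (Fin n) (Fin N)) →
    (IIA f × WPP f) ⇔
    Σ (Fin N) (λ i → DirectDictator f i ×
      Σ (SWF (Fin n) (Fin N ∖[ i ])) (λ g →
        Defers f i g × ClericalDictatorial (Fin n) (Fin N ∖[ i ]) g))
theorem4 (suc (suc (suc m))) N (s≤s (s≤s (s≤s _))) f = mk⇔ dictator-and-deferral iia-and-wpp
  where
  I = finIndexing N
  DeferringDictator : Set₁
  DeferringDictator = Σ (Fin N) λ i → DirectDictator f i ×
    Σ (SWF (Fin (3 + m)) (Fin N ∖[ i ])) λ g →
      Defers f i g × ClericalDictatorial (Fin (3 + m)) (Fin N ∖[ i ]) g

  dictator-and-deferral : IIA f × WPP f → DeferringDictator
  dictator-and-deferral (iia , wpp) with Arrow.arrow _≟ᶠ_ (fin-three m) I iiaᴵ wpp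
    where iiaᴵ = IIA⇒indexedIIA {f = f} iia
  ... | i , dictator =
    i , dictator , defer I f i , defers I _≟ᶠ_ iiaᴵ (inj₁ dictator) ,
    clericalDictatorial _ _≟ᶠ_ (fin-enumeration _) (I ∖ᵢ i) (defer-indexedIIA I iiaᴵ i) (n<1+n _)
    where iiaᴵ = IIA⇒indexedIIA {f = f} iia

  iia-and-wpp : DeferringDictator → IIA f × WPP f
  iia-and-wpp (i , dictator , g , defers , cd) =
    dictator-defers-IIA {h = f} {g = g} (inj₁ dictator) defers g-IIA ,
    λ R x y unan → dictator-⊏ {h = f} dictator R (unan i)
    where
    g-IIA : IIA g
    g-IIA = Sum.[ ⊥-elim ∘ atLeastThree⇒¬atMostTwo (fin-three m) , id ] (clericalDictatorial⇒IIA _≟ᶠ_ cd)
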